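{- Let $p>2$ be a prime. Then $P(p,2p)=P(p,p)=p\,O(p)$.
   Context: $O(p)$ denotes the multiplicative order of $2$ modulo $p$. For positive integers $m,n$, let $\mathbf{Z}_m$ be the ring of integers modulo $m$ and define $T:\mathbf{Z}_m^n\to\mathbf{Z}_m^n$ by $T(a_0,\dots,a_{n-1})=(a_0+a_1,a_1+a_2,\dots,a_{n-2}+a_{n-1},a_{n-1}+a_0)$. For $\mathbf{a}\in\mathbf{Z}_m^n$, the cycle length of $(T^k\mathbf{a})_{k\ge0}$ is the smallest positive integer $P$ for which there exists $N$ with $T^{k+P}\mathbf{a}=T^k\mathbf{a}$ for all $k\ge N$. The period $P(m,n)$ is the maximum of these cycle lengths over all $\mathbf{a}\in\mathbf{Z}_m^n$. -}

module Defs where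

open import Data.Nat using (ℕ; zero; suc; _+_; _*_; _∸_; _^_; _≤_; _<_)
open import Data.Nat.DivMod using (_mod_)
open import Data.Nat.Divisibility using (_∣_)
open import Data.Fin using (Fin; toℕ)
open import Data.Vec using (Vec; []; _∷_; _∷ʳ_; zipWith)
open import Data.Product using (Σ; _×_; ∃)
open import Relation.Binary.PropositionalEquality using (_≡_)

_⊕_ : ∀ {m} → Fin m → Fin m → Fin m
_⊕_ {suc m} a b = (toℕ a + toℕ b) mod (suc m)

rotate : ∀ {A : Set} {n} → Vec A n → Vec A n
rotate []       = []
rotate (x ∷ xs) = xs ∷ʳ x

T : ∀ {m n} → Vec (Fin m) n → Vec (Fin m) n
T a = zipWith _⊕_ a (rotate a)

Tⁿ : ∀ {m n} → ℕ → Vec (Fin m) n → Vec (Fin m) n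
Tⁿ zero    a = a
Tⁿ (suc k) a = T (Tⁿ k a)

IsEventualPeriod : ∀ {m n} → Vec (Fin m) n → ℕ → Set
IsEventualPeriod a P = ∃ λ N → ∀ k → N ≤ k → Tⁿ (k + P) a ≡ Tⁿ k a

IsCycleLength : ∀ {m n} → Vec (Fin m) n → ℕ → Set
IsCycleLength a P =
  0 < P × IsEventualPeriod a P × (∀ Q → 0 < Q → IsEventualPeriod a Q → P ≤ Q)

IsPeriod : ℕ → ℕ → ℕ → Set
IsPeriod m n P =
  (Σ (Vec (Fin m) n) λ a → IsCycleLength a P) ×
  (∀ (a : Vec (Fin m) n) Q → IsCycleLength a Q → Q ≤ P)

IsOrderOf2 : ℕ → ℕ → Set
IsOrderOf2 p k = 0 < k × p ∣ 2 ^ k ∸ 1 × (∀ j → 0 < j → p ∣ 2 ^ j ∸ 1 → k ≤ j)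

{-# OPTIONS --safe #-}
-- Read a ∈ Z_p^n as the n-periodic sequence fᵢ = a_{i mod n}; then T^k acts as fᵢ ↦ Σⱼ C(k,j) fᵢ₊ⱼ, and
-- since p ∣ C(p,j) for 0 < j < p, T^p f ≡ h (mod p) with hᵢ = fᵢ + fᵢ₊ₚ. When n ∣ 2p, h has period p, so
-- T^p h ≡ 2h and T^{(m+1)p} f ≡ 2^m h; hence T^{p + p·O(p)} = T^p on all of Z_p^n. For a = (0,…,0,1),
-- h vanishes below p − 1 and hₚ₋₁ ∈ {1, 2} is a unit. Writing an eventual period as Q = r + qp and
-- comparing T^{k+Q} with T^k on h gives 2^q T^r h ≡ h; at i = p − 1 − r this forces r = 0, and then
-- 2^q ≡ 1, so Q ≥ p·O(p).
module Submission where

open import Defs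
open import Data.Nat using (ℕ; _*_; _<_)
open import Data.Nat.Primality using (Prime)
open import Data.Product using (_×_)

open import Data.Empty using (⊥-elim)
open import Data.Fin using (Fin; toℕ; fromℕ<) renaming (zero to 0F)
open import Data.Fin.Properties using (toℕ-injective; toℕ-fromℕ<; toℕ<n)
open import Data.Nat using (zero; suc; _+_; _∸_; _^_; _≤_; _!; z≤n; s≤s; NonZero)
open import Data.Nat.Combinatorics using (_C_; nCn≡1; nCk≡n!/k![n-k]!; k![n∸k]!∣n!; nCk+nC[k+1]≡[n+1]C[k+1])
open import Data.Nat.Divisibility
open import Data.Nat.DivMod hiding (_mod_)
open import Data.Nat.Primality using (euclidsLemma; ¬prime[1])
open import Data.Nat.Properties
open import Data.Product using (_,_; proj₁)
open import Data.Sum using (inj₁; inj₂)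
open import Data.Vec using (Vec; []; _∷_; _∷ʳ_; zipWith; replicate)
open import Data.Nat.Tactic.RingSolver using (solve-∀)
open import Function using (_∘_)
open import Relation.Nullary using (¬_)
open import Relation.Binary.PropositionalEquality

open import Algebra.Properties.CommutativeSemigroup +-commutativeSemigroup using (interchange; x∙yz≈xz∙y)

prime∤* : ∀ {p a b} → Prime p → ¬ p ∣ a → ¬ p ∣ b → ¬ p ∣ a * b
prime∤* {a = a} {b} p-prime p∤a p∤b p∣ab with euclidsLemma a b p-prime p∣ab
... | inj₁ p∣a = p∤a p∣a
... | inj₂ p∣b = p∤b p∣b

prime∤! : ∀ {p m} → Prime p → m < p → ¬ p ∣ m !
prime∤! {m = zero}  p-prime _   p∣1 = ¬prime[1] (subst Prime (∣1⇒≡1 p∣1) p-prime)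
prime∤! {m = suc m} p-prime m<p =
  prime∤* p-prime (λ p∣1+m → <⇒≱ m<p (∣⇒≤ p∣1+m)) (prime∤! p-prime (<-trans (n<1+n m) m<p))

prime∤2^ : ∀ {p} → Prime p → 2 < p → ∀ m → ¬ p ∣ 2 ^ m
prime∤2^ p-prime 2<p zero    = >⇒∤ (<-trans (n<1+n 1) 2<p)
prime∤2^ p-prime 2<p (suc m) = prime∤* p-prime (>⇒∤ 2<p) (prime∤2^ p-prime 2<p m)

prime∣C : ∀ {p k} → Prime p → 0 < k → k < p → p ∣ p C k
prime∣C {p@(suc n)} {k} p-prime 0<k k<p with euclidsLemma (p C k) (k ! * (p ∸ k) !) p-prime p∣C*k![p∸k]!
  where
  instance _ = k !* (p ∸ k) !≢0
  C*k![p∸k]!≡p! : (p C k) * (k ! * (p ∸ k) !) ≡ p !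
  C*k![p∸k]!≡p! = trans (cong (_* (k ! * (p ∸ k) !)) (nCk≡n!/k![n-k]! (<⇒≤ k<p)))
                        (m/n*n≡m (k![n∸k]!∣n! (<⇒≤ k<p)))
  p∣C*k![p∸k]! : p ∣ (p C k) * (k ! * (p ∸ k) !)
  p∣C*k![p∸k]! = subst (p ∣_) (sym C*k![p∸k]!≡p!) (m∣m*n (n !))
... | inj₁ p∣C = p∣C
... | inj₂ p∣k![p∸k]! = ⊥-elim (prime∤* p-prime (prime∤! p-prime k<p)
                                  (prime∤! p-prime (∸-monoʳ-< 0<k (<⇒≤ k<p))) p∣k![p∸k]!)

∑ : ℕ → (ℕ → ℕ) → ℕ
∑ zero    F = 0
∑ (suc n) F = F 0 + ∑ n (F ∘ suc)

∑-cong : ∀ n {F G} → (∀ j → F j ≡ G j) → ∑ n F ≡ ∑ n G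
∑-cong zero    F≗G = refl
∑-cong (suc n) F≗G = cong₂ _+_ (F≗G 0) (∑-cong n (F≗G ∘ suc))

∑-zero : ∀ n → ∑ n (λ _ → 0) ≡ 0
∑-zero zero    = refl
∑-zero (suc n) = ∑-zero n

∑-distrib-+ : ∀ n F G → ∑ n (λ j → F j + G j) ≡ ∑ n F + ∑ n G
∑-distrib-+ zero    F G = refl
∑-distrib-+ (suc n) F G =
  trans (cong (F 0 + G 0 +_) (∑-distrib-+ n (F ∘ suc) (G ∘ suc))) (interchange (F 0) (G 0) _ _)

∑-suc : ∀ n F → ∑ (suc n) F ≡ ∑ n F + F n
∑-suc zero    F = +-comm (F 0) 0
∑-suc (suc n) F = trans (cong (F 0 +_) (∑-suc n (F ∘ suc))) (sym (+-assoc (F 0) _ _))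

∣-∑ : ∀ {d} n F → (∀ j → j < n → d ∣ F j) → d ∣ ∑ n F
∣-∑ {d} zero    F d∣F = d ∣0
∣-∑     (suc n) F d∣F =
  ∣m∣n⇒∣m+n (d∣F 0 (s≤s z≤n)) (∣-∑ n (F ∘ suc) (λ j j<n → d∣F (suc j) (s≤s j<n)))

Tˢ : ℕ → (ℕ → ℕ) → ℕ → ℕ
Tˢ zero    f i = f i
Tˢ (suc k) f i = Tˢ k f i + Tˢ k f (suc i)

Tˢ-+ : ∀ k l f i → Tˢ (k + l) f i ≡ Tˢ k (Tˢ l f) i
Tˢ-+ zero    l f i = refl
Tˢ-+ (suc k) l f i = cong₂ _+_ (Tˢ-+ k l f i) (Tˢ-+ k l f (suc i))

Tˢ-*ˡ : ∀ k c f i → Tˢ k (λ j → c * f j) i ≡ c * Tˢ k f i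
Tˢ-*ˡ zero    c f i = refl
Tˢ-*ˡ (suc k) c f i =
  trans (cong₂ _+_ (Tˢ-*ˡ k c f i) (Tˢ-*ˡ k c f (suc i))) (sym (*-distribˡ-+ c _ _))

Tˢ-binomial : ∀ k n f i → k < n → Tˢ k f i ≡ ∑ n (λ j → (k C j) * f (i + j))
Tˢ-binomial zero (suc n) f i _ = sym (begin
    1 * f (i + 0) + ∑ n (λ _ → 0)  ≡⟨ cong₂ _+_ (*-identityˡ _) (∑-zero n) ⟩
    f (i + 0) + 0                  ≡⟨ +-identityʳ _ ⟩
    f (i + 0)                      ≡⟨ cong f (+-identityʳ i) ⟩
    f i                            ∎)
  where open ≡-Reasoning
Tˢ-binomial (suc k) (suc n) f i (s≤s k<n) = begin
    Tˢ k f i + Tˢ k f (suc i)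
  ≡⟨ cong₂ _+_ (Tˢ-binomial k (suc n) f i (m<n⇒m<1+n k<n)) (Tˢ-binomial k n f (suc i) k<n) ⟩
    (f₀ + ∑ n (λ j → (k C suc j) * g j)) + ∑ n (λ j → (k C j) * f (suc i + j))
  ≡⟨ cong (f₀ + ∑ n (λ j → (k C suc j) * g j) +_)
          (∑-cong n (λ j → cong (λ x → (k C j) * f x) (sym (+-suc i j)))) ⟩
    (f₀ + ∑ n (λ j → (k C suc j) * g j)) + ∑ n (λ j → (k C j) * g j)
  ≡⟨ x∙yz≈xz∙y f₀ _ _ ⟨
    f₀ + (∑ n (λ j → (k C j) * g j) + ∑ n (λ j → (k C suc j) * g j))
  ≡⟨ cong (f₀ +_) (∑-distrib-+ n _ _) ⟨
    f₀ + ∑ n (λ j → (k C j) * g j + (k C suc j) * g j)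
  ≡⟨ cong (f₀ +_) (∑-cong n pascal) ⟩
    f₀ + ∑ n (λ j → (suc k C suc j) * g j)
  ∎
  where
  open ≡-Reasoning
  -- the j = 0 terms: k C 0 and suc k C 0 both compute to 1
  f₀ : ℕ
  f₀ = 1 * f (i + 0)
  g : ℕ → ℕ
  g j = f (i + suc j)
  pascal : ∀ j → (k C j) * g j + (k C suc j) * g j ≡ (suc k C suc j) * g j
  pascal j = trans (sym (*-distribʳ-+ (g j) (k C j) (k C suc j)))
                   (cong (_* g j) (nCk+nC[k+1]≡[n+1]C[k+1] k j))

infix 4 _≡_mod_
_≡_mod_ : ℕ → ℕ → (d : ℕ) → .{{NonZero d}} → Set
_≡_mod_ a b d = a % d ≡ b % d

module _ {d : ℕ} .{{_ : NonZero d}} where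

  +-cong-mod : ∀ {a b c e} → a ≡ b mod d → c ≡ e mod d → a + c ≡ b + e mod d
  +-cong-mod {a} {b} {c} {e} a≡b c≡e = begin
    (a + c) % d            ≡⟨ %-distribˡ-+ a c d ⟩
    (a % d + c % d) % d    ≡⟨ cong₂ (λ x y → (x + y) % d) a≡b c≡e ⟩
    (b % d + e % d) % d    ≡⟨ %-distribˡ-+ b e d ⟨
    (b + e) % d            ∎
    where open ≡-Reasoning

  *-cong-mod : ∀ {a b c e} → a ≡ b mod d → c ≡ e mod d → a * c ≡ b * e mod d
  *-cong-mod {a} {b} {c} {e} a≡b c≡e = begin
    (a * c) % d            ≡⟨ %-distribˡ-* a c d ⟩
    (a % d * (c % d)) % d  ≡⟨ cong₂ (λ x y → (x * y) % d) a≡b c≡e ⟩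
    (b % d * (e % d)) % d  ≡⟨ %-distribˡ-* b e d ⟨
    (b * e) % d            ∎
    where open ≡-Reasoning

  *-congˡ-mod : ∀ a {b c} → b ≡ c mod d → a * b ≡ a * c mod d
  *-congˡ-mod a {b} {c} = *-cong-mod {a} {a} {b} {c} refl

  *-congʳ-mod : ∀ {a b} c → a ≡ b mod d → a * c ≡ b * c mod d
  *-congʳ-mod {a} {b} c a≡b = *-cong-mod {a} {b} {c} {c} a≡b refl

  ≡-mod⇒∣∸ : ∀ {a b} → a ≡ b mod d → d ∣ a ∸ b
  ≡-mod⇒∣∸ {a} {b} a≡b = divides (a / d ∸ b / d) (begin
    a ∸ b
      ≡⟨ cong₂ _∸_ (m≡m%n+[m/n]*n a d) (m≡m%n+[m/n]*n b d) ⟩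
    (a % d + a / d * d) ∸ (b % d + b / d * d)
      ≡⟨ cong (λ x → (x + a / d * d) ∸ (b % d + b / d * d)) a≡b ⟩
    (b % d + a / d * d) ∸ (b % d + b / d * d)
      ≡⟨ [m+n]∸[m+o]≡n∸o (b % d) _ _ ⟩
    a / d * d ∸ b / d * d
      ≡⟨ *-distribʳ-∸ d (a / d) (b / d) ⟨
    (a / d ∸ b / d) * d
      ∎)
    where open ≡-Reasoning

  Tˢ-cong-mod : ∀ {f g} → (∀ j → f j ≡ g j mod d) → ∀ k i → Tˢ k f i ≡ Tˢ k g i mod d
  Tˢ-cong-mod f≡g zero    i = f≡g i
  Tˢ-cong-mod f≡g (suc k) i = +-cong-mod (Tˢ-cong-mod f≡g k i) (Tˢ-cong-mod f≡g k (suc i))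

  2^order≡1 : ∀ {o} → IsOrderOf2 d o → 2 ^ o ≡ 1 mod d
  2^order≡1 {o} (_ , d∣2^o∸1 , _) =
    trans (cong (_% d) (sym (m∸n+n≡m (m^n>0 2 o)))) (%-remove-+ˡ 1 d∣2^o∸1)

  *-cancelˡ-mod⇒∣∸ : Prime d → ∀ {a b c} → ¬ d ∣ a → a * b ≡ a * c mod d → d ∣ b ∸ c
  *-cancelˡ-mod⇒∣∸ d-prime {a} {b} {c} d∤a ab≡ac with euclidsLemma a (b ∸ c) d-prime d∣a[b∸c]
    where
    d∣a[b∸c] : d ∣ a * (b ∸ c)
    d∣a[b∸c] = subst (d ∣_) (sym (*-distribˡ-∸ a b c)) (≡-mod⇒∣∸ ab≡ac)
  ... | inj₁ d∣a   = ⊥-elim (d∤a d∣a)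
  ... | inj₂ d∣b∸c = d∣b∸c

Periodic : ℕ → (ℕ → ℕ) → Set
Periodic P f = ∀ i → f (i + P) ≡ f i

fold : ℕ → (ℕ → ℕ) → ℕ → ℕ
fold P f i = f i + f (i + P)

fold-periodic : ∀ P f → Periodic (2 * P) f → Periodic P (fold P f)
fold-periodic P f f-periodic i = begin
  f (i + P) + f (i + P + P)  ≡⟨ cong (λ x → f (i + P) + f x) (+-assoc i P P) ⟩
  f (i + P) + f (i + (P + P)) ≡⟨ cong (λ x → f (i + P) + f (i + (P + x))) (+-identityʳ P) ⟨
  f (i + P) + f (i + 2 * P)  ≡⟨ cong (f (i + P) +_) (f-periodic i) ⟩
  f (i + P) + f i            ≡⟨ +-comm (f (i + P)) (f i) ⟩
  f i + f (i + P)            ∎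
  where open ≡-Reasoning

Tˢ-vanishes : ∀ {h m} → (∀ j → j < m → h j ≡ 0) → ∀ r i → i + r < m → Tˢ r h i ≡ 0
Tˢ-vanishes         h-vanishes zero    i i<m   = h-vanishes i (subst (_< _) (+-identityʳ i) i<m)
Tˢ-vanishes {m = m} h-vanishes (suc r) i i+r<m = cong₂ _+_
  (Tˢ-vanishes h-vanishes r i (<-trans (+-monoʳ-< i (n<1+n r)) i+r<m))
  (Tˢ-vanishes h-vanishes r (suc i) (subst (_< m) (+-suc i r) i+r<m))

Tˢ-first-nonzero : ∀ {h m} → (∀ j → j < m → h j ≡ 0) → ∀ r i → i + r ≡ m → Tˢ r h i ≡ h m
Tˢ-first-nonzero {h} h-vanishes zero    i i≡m   = cong h (trans (sym (+-identityʳ i)) i≡m)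
Tˢ-first-nonzero     h-vanishes (suc r) i i+r≡m = cong₂ _+_
  (Tˢ-vanishes h-vanishes r i (subst (_ <_) i+r≡m (+-monoʳ-< i (n<1+n r))))
  (Tˢ-first-nonzero h-vanishes r (suc i) (trans (sym (+-suc i r)) i+r≡m))

at : ∀ {m n} → Vec (Fin m) n → ℕ → ℕ
at []       _       = 0
at (x ∷ xs) zero    = toℕ x
at (x ∷ xs) (suc k) = at xs k

at-< : ∀ {m n} (a : Vec (Fin (suc m)) n) k → at a k < suc m
at-< []       _       = s≤s z≤n
at-< (x ∷ xs) zero    = toℕ<n x
at-< (x ∷ xs) (suc k) = at-< xs k

at-zipWith-⊕ : ∀ {m n} (a b : Vec (Fin (suc m)) n) k → at (zipWith _⊕_ a b) k ≡ (at a k + at b k) % suc m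
at-zipWith-⊕ []       []       _       = refl
at-zipWith-⊕ (x ∷ xs) (y ∷ ys) zero    = toℕ-fromℕ< _
at-zipWith-⊕ (x ∷ xs) (y ∷ ys) (suc k) = at-zipWith-⊕ xs ys k

at-∷ʳ-< : ∀ {m n} (xs : Vec (Fin m) n) x {k} → k < n → at (xs ∷ʳ x) k ≡ at xs k
at-∷ʳ-< (y ∷ xs) x {zero}  _   = refl
at-∷ʳ-< (y ∷ xs) x {suc k} k<n = at-∷ʳ-< xs x (≤-pred k<n)

at-∷ʳ-≡ : ∀ {m n} (xs : Vec (Fin m) n) x → at (xs ∷ʳ x) n ≡ toℕ x
at-∷ʳ-≡ []       x = refl
at-∷ʳ-≡ (y ∷ xs) x = at-∷ʳ-≡ xs x

at-replicate-zero : ∀ {m} n k → at (replicate {A = Fin (suc m)} n 0F) k ≡ 0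
at-replicate-zero zero    k       = refl
at-replicate-zero (suc n) zero    = refl
at-replicate-zero (suc n) (suc k) = at-replicate-zero n k

at-rotate : ∀ {m n} (a : Vec (Fin m) (suc n)) k → k < suc n → at (rotate a) k ≡ at a (suc k % suc n)
at-rotate {n = n} (x ∷ xs) k k<1+n with m≤n⇒m<n∨m≡n (≤-pred k<1+n)
... | inj₁ k<n  = trans (at-∷ʳ-< xs x k<n) (cong (at (x ∷ xs)) (sym (m<n⇒m%n≡m (s≤s k<n))))
... | inj₂ refl = trans (at-∷ʳ-≡ xs x) (cong (at (x ∷ xs)) (sym (n%n≡0 (suc n))))

at-injective : ∀ {m n} (a b : Vec (Fin m) n) → (∀ k → k < n → at a k ≡ at b k) → a ≡ b
at-injective []       []       _    = refl
at-injective (x ∷ xs) (y ∷ ys) a≡b =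
  cong₂ _∷_ (toℕ-injective (a≡b 0 (s≤s z≤n))) (at-injective xs ys (λ k k<n → a≡b (suc k) (s≤s k<n)))

seq : ∀ {m n} → Vec (Fin m) (suc n) → ℕ → ℕ
seq {n = n} a i = at a (i % suc n)

seq-injective : ∀ {m n} (a b : Vec (Fin m) (suc n)) → (∀ i → seq a i ≡ seq b i) → a ≡ b
seq-injective {n = n} a b a≡b = at-injective a b λ k k<1+n →
  trans (cong (at a) (sym (m<n⇒m%n≡m k<1+n))) (trans (a≡b k) (cong (at b) (m<n⇒m%n≡m k<1+n)))

seq-periodic : ∀ {m n P} (a : Vec (Fin m) (suc n)) → suc n ∣ P → Periodic P (seq a)
seq-periodic {n = n} a (divides q refl) i = cong (at a) ([m+kn]%n≡m%n i q (suc n))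

seq-T : ∀ {m n} (a : Vec (Fin (suc m)) (suc n)) i → seq (T a) i ≡ (seq a i + seq a (suc i)) % suc m
seq-T {m} {n} a i = begin
  at (T a) (i % suc n)                          ≡⟨ at-zipWith-⊕ a (rotate a) (i % suc n) ⟩
  (seq a i + at (rotate a) (i % suc n)) % suc m ≡⟨ cong (λ x → (seq a i + x) % suc m) rotated ⟩
  (seq a i + seq a (suc i)) % suc m             ∎
  where
  open ≡-Reasoning
  rotated : at (rotate a) (i % suc n) ≡ seq a (suc i)
  rotated = trans (at-rotate a (i % suc n) (m%n<n i (suc n)))
                  (cong (at a) (+-cong-mod {a = 1} {1} {i % suc n} {i} refl (m%n%n≡m%n i (suc n))))

seq-Tⁿ : ∀ {m n} k (a : Vec (Fin (suc m)) (suc n)) i → seq (Tⁿ k a) i ≡ Tˢ k (seq a) i % suc m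
seq-Tⁿ         zero    a i = sym (m<n⇒m%n≡m (at-< a _))
seq-Tⁿ {m} {n} (suc k) a i = begin
  seq (T (Tⁿ k a)) i
    ≡⟨ seq-T (Tⁿ k a) i ⟩
  (seq (Tⁿ k a) i + seq (Tⁿ k a) (suc i)) % suc m
    ≡⟨ cong₂ (λ x y → (x + y) % suc m) (seq-Tⁿ k a i) (seq-Tⁿ k a (suc i)) ⟩
  (Tˢ k (seq a) i % suc m + Tˢ k (seq a) (suc i) % suc m) % suc m
    ≡⟨ %-distribˡ-+ (Tˢ k (seq a) i) _ (suc m) ⟨
  Tˢ (suc k) (seq a) i % suc m
    ∎
  where open ≡-Reasoning

Tⁿ-+ : ∀ {m n} k l (a : Vec (Fin m) n) → Tⁿ (k + l) a ≡ Tⁿ k (Tⁿ l a)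
Tⁿ-+ zero    l a = refl
Tⁿ-+ (suc k) l a = cong T (Tⁿ-+ k l a)

eventualPeriod : ∀ {m n} (a : Vec (Fin m) n) N P → Tⁿ (N + P) a ≡ Tⁿ N a → IsEventualPeriod a P
eventualPeriod a N P a-period = N , λ k N≤k → begin
  Tⁿ (k + P) a              ≡⟨ cong (λ x → Tⁿ (x + P) a) (m∸n+n≡m N≤k) ⟨
  Tⁿ (k ∸ N + N + P) a      ≡⟨ cong (λ x → Tⁿ x a) (+-assoc (k ∸ N) N P) ⟩
  Tⁿ (k ∸ N + (N + P)) a    ≡⟨ Tⁿ-+ (k ∸ N) (N + P) a ⟩
  Tⁿ (k ∸ N) (Tⁿ (N + P) a) ≡⟨ cong (Tⁿ (k ∸ N)) a-period ⟩
  Tⁿ (k ∸ N) (Tⁿ N a)       ≡⟨ Tⁿ-+ (k ∸ N) N a ⟨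
  Tⁿ (k ∸ N + N) a          ≡⟨ cong (λ x → Tⁿ x a) (m∸n+n≡m N≤k) ⟩
  Tⁿ k a                    ∎
  where open ≡-Reasoning

onlyLast : ∀ {m} ℓ → Fin (suc m) → Vec (Fin (suc m)) (suc ℓ)
onlyLast ℓ x = replicate ℓ 0F ∷ʳ x

seq-onlyLast-< : ∀ {m ℓ j} (x : Fin (suc m)) → j < ℓ → seq (onlyLast ℓ x) j ≡ 0
seq-onlyLast-< {ℓ = ℓ} {j} x j<ℓ = begin
  at (onlyLast ℓ x) (j % suc ℓ)  ≡⟨ cong (at (onlyLast ℓ x)) (m<n⇒m%n≡m (m<n⇒m<1+n j<ℓ)) ⟩
  at (replicate ℓ 0F ∷ʳ x) j     ≡⟨ at-∷ʳ-< (replicate ℓ 0F) x j<ℓ ⟩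
  at (replicate ℓ 0F) j          ≡⟨ at-replicate-zero ℓ j ⟩
  0                              ∎
  where open ≡-Reasoning

seq-onlyLast-≡ : ∀ {m} ℓ (x : Fin (suc m)) → seq (onlyLast ℓ x) ℓ ≡ toℕ x
seq-onlyLast-≡ ℓ x = trans (cong (at (onlyLast ℓ x)) (m<n⇒m%n≡m (n<1+n ℓ))) (at-∷ʳ-≡ (replicate ℓ 0F) x)

module _ {n : ℕ} (p-prime : Prime (suc n)) where

  private
    p : ℕ
    p = suc n

  frobenius : ∀ f i → Tˢ p f i ≡ fold p f i mod p
  frobenius f i = trans (cong (_% p) expansion) (%-remove-+ʳ (fold p f i) p∣inner)
    where
    open ≡-Reasoning
    inner : ℕ → ℕ
    inner j = (p C suc j) * f (i + suc j)
    p∣inner : p ∣ ∑ n inner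
    p∣inner = ∣-∑ n inner (λ j j<n → ∣m⇒∣m*n _ (prime∣C p-prime (s≤s z≤n) (s≤s j<n)))
    expansion : Tˢ p f i ≡ fold p f i + ∑ n inner
    expansion = begin
      Tˢ p f i                              ≡⟨ Tˢ-binomial p (suc p) f i ≤-refl ⟩
      1 * f (i + 0) + ∑ p inner             ≡⟨ cong (1 * f (i + 0) +_) (∑-suc n inner) ⟩
      1 * f (i + 0) + (∑ n inner + inner n) ≡⟨ cong₂ (λ x y → x + (∑ n inner + y)) first last ⟩
      f i + (∑ n inner + f (i + p))         ≡⟨ x∙yz≈xz∙y (f i) _ _ ⟩
      fold p f i + ∑ n inner                ∎
      where
      first : 1 * f (i + 0) ≡ f i
      first = trans (*-identityˡ _) (cong f (+-identityʳ i))
      last : inner n ≡ f (i + p)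
      last = trans (cong (_* f (i + p)) (nCn≡1 p)) (*-identityˡ _)

  Tˢ-p-doubles : ∀ {g} → Periodic p g → ∀ i → Tˢ p g i ≡ 2 * g i mod p
  Tˢ-p-doubles {g} g-periodic i =
    trans (frobenius g i) (cong (λ x → (g i + x) % p) (trans (g-periodic i) (sym (+-identityʳ (g i)))))

  Tˢ-multiple-of-p : ∀ {f} → Periodic (2 * p) f → ∀ m i → Tˢ (suc m * p) f i ≡ 2 ^ m * fold p f i mod p
  Tˢ-multiple-of-p {f} f-periodic zero i = begin
    Tˢ (p + 0) f i % p   ≡⟨ cong (λ k → Tˢ k f i % p) (+-identityʳ p) ⟩
    Tˢ p f i % p         ≡⟨ frobenius f i ⟩
    fold p f i % p       ≡⟨ cong (_% p) (*-identityˡ (fold p f i)) ⟨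
    1 * fold p f i % p   ∎
    where open ≡-Reasoning
  Tˢ-multiple-of-p {f} f-periodic (suc m) i = begin
    Tˢ (p + suc m * p) f i % p                ≡⟨ cong (_% p) (Tˢ-+ p (suc m * p) f i) ⟩
    Tˢ p (Tˢ (suc m * p) f) i % p             ≡⟨ Tˢ-cong-mod (Tˢ-multiple-of-p f-periodic m) p i ⟩
    Tˢ p (λ j → 2 ^ m * fold p f j) i % p     ≡⟨ cong (_% p) (Tˢ-*ˡ p (2 ^ m) (fold p f) i) ⟩
    2 ^ m * Tˢ p (fold p f) i % p             ≡⟨ *-congˡ-mod (2 ^ m) (Tˢ-p-doubles (fold-periodic p f f-periodic) i) ⟩
    2 ^ m * (2 * fold p f i) % p              ≡⟨ cong (_% p) (*-assoc (2 ^ m) 2 (fold p f i)) ⟨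
    2 ^ m * 2 * fold p f i % p                ≡⟨ cong (λ x → x * fold p f i % p) (*-comm (2 ^ m) 2) ⟩
    2 * 2 ^ m * fold p f i % p                ∎
    where open ≡-Reasoning

  Tˢ-eventually-periodic : ∀ {f o} → IsOrderOf2 p o → Periodic (2 * p) f →
                           ∀ i → Tˢ (p + p * o) f i ≡ Tˢ p f i mod p
  Tˢ-eventually-periodic {f} {o} order f-periodic i = begin
    Tˢ (p + p * o) f i % p  ≡⟨ cong (λ k → Tˢ (p + k) f i % p) (*-comm p o) ⟩
    Tˢ (suc o * p) f i % p  ≡⟨ Tˢ-multiple-of-p f-periodic o i ⟩
    2 ^ o * fold p f i % p  ≡⟨ *-congʳ-mod {a = 2 ^ o} {1} (fold p f i) (2^order≡1 order) ⟩
    1 * fold p f i % p      ≡⟨ cong (_% p) (*-identityˡ (fold p f i)) ⟩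
    fold p f i % p          ≡⟨ frobenius f i ⟨
    Tˢ p f i % p            ∎
    where open ≡-Reasoning

  eventual-period-on-fold : ∀ {f} → Periodic (2 * p) f →
    ∀ {Q} N → (∀ k → N ≤ k → ∀ i → Tˢ (k + Q) f i ≡ Tˢ k f i mod p) →
    ∀ r q → Q ≡ r + q * p → ∀ i → 2 ^ (N + q) * Tˢ r (fold p f) i ≡ 2 ^ N * fold p f i mod p
  eventual-period-on-fold {f} f-periodic {Q} N Q-period r q Q≡r+qp i = begin
    2 ^ (N + q) * Tˢ r h i % p            ≡⟨ cong (_% p) (Tˢ-*ˡ r (2 ^ (N + q)) h i) ⟨
    Tˢ r (λ j → 2 ^ (N + q) * h j) i % p  ≡⟨ Tˢ-cong-mod (Tˢ-multiple-of-p f-periodic (N + q)) r i ⟨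
    Tˢ r (Tˢ (suc (N + q) * p) f) i % p   ≡⟨ cong (_% p) (Tˢ-+ r _ f i) ⟨
    Tˢ (r + suc (N + q) * p) f i % p      ≡⟨ cong (λ k → Tˢ k f i % p) index ⟨
    Tˢ (suc N * p + Q) f i % p            ≡⟨ Q-period (suc N * p) (≤-trans (n≤1+n N) (m≤m*n (suc N) p)) i ⟩
    Tˢ (suc N * p) f i % p                ≡⟨ Tˢ-multiple-of-p f-periodic N i ⟩
    2 ^ N * h i % p                       ∎
    where
    open ≡-Reasoning
    h : ℕ → ℕ
    h = fold p f
    rearrange : ∀ N q r p → suc N * p + (r + q * p) ≡ r + suc (N + q) * p
    rearrange = solve-∀
    index : suc N * p + Q ≡ r + suc (N + q) * p
    index = trans (cong (suc N * p +_) Q≡r+qp) (rearrange N q r p)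

  eventual-period-≥ : ∀ {f o} → 2 < p → IsOrderOf2 p o → Periodic (2 * p) f →
    (∀ j → j < n → fold p f j ≡ 0) → ¬ p ∣ fold p f n →
    ∀ {Q} N → 0 < Q → (∀ k → N ≤ k → ∀ i → Tˢ (k + Q) f i ≡ Tˢ k f i mod p) → p * o ≤ Q
  eventual-period-≥ {f} {o} 2<p (_ , _ , o-least) f-periodic h-vanishes p∤h[n] {Q} N 0<Q Q-period =
    split (Q % p) (Q / p) (m≡m%n+[m/n]*n Q p) (m%n<n Q p)
    where
    open ≡-Reasoning
    h : ℕ → ℕ
    h = fold p f
    shifted : ∀ r q → Q ≡ r + q * p → ∀ i → 2 ^ (N + q) * Tˢ r h i ≡ 2 ^ N * h i mod p
    shifted = eventual-period-on-fold f-periodic N Q-period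

    p∤2^m*h[n] : ∀ m → ¬ p ∣ 2 ^ m * h n
    p∤2^m*h[n] m = prime∤* p-prime (prime∤2^ p-prime 2<p m) p∤h[n]

    split : ∀ r q → Q ≡ r + q * p → r < p → p * o ≤ Q
    split zero zero Q≡0 _ = ⊥-elim (<-irrefl (sym Q≡0) 0<Q)
    split zero (suc q) Q≡qp _ =
      subst (p * o ≤_) (trans (*-comm p (suc q)) (sym Q≡qp))
            (*-monoʳ-≤ p (o-least (suc q) (s≤s z≤n) p∣2^q∸1))
      where
      A : ℕ
      A = 2 ^ N * h n
      regroup : ∀ x y z → x * y * z ≡ x * z * y
      regroup = solve-∀
      p∣2^q∸1 : p ∣ 2 ^ suc q ∸ 1
      p∣2^q∸1 = *-cancelˡ-mod⇒∣∸ p-prime (p∤2^m*h[n] N) (begin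
        A * 2 ^ suc q % p           ≡⟨ cong (_% p) (regroup (2 ^ N) (h n) (2 ^ suc q)) ⟩
        2 ^ N * 2 ^ suc q * h n % p ≡⟨ cong (λ x → x * h n % p) (^-distribˡ-+-* 2 N (suc q)) ⟨
        2 ^ (N + suc q) * h n % p   ≡⟨ shifted 0 (suc q) Q≡qp n ⟩
        A % p                       ≡⟨ cong (_% p) (*-identityʳ A) ⟨
        A * 1 % p                   ∎)
    split (suc r) q Q≡r+qp r<p = ⊥-elim (p∤2^m*h[n] (N + q) (m%n≡0⇒n∣m _ p (begin
        2 ^ (N + q) * h n % p             ≡⟨ cong (λ x → 2 ^ (N + q) * x % p) h[n]≡Tʳh[i] ⟩
        2 ^ (N + q) * Tˢ (suc r) h i % p  ≡⟨ shifted (suc r) q Q≡r+qp i ⟩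
        2 ^ N * h i % p                   ≡⟨ cong (λ x → 2 ^ N * x % p) (h-vanishes i i<n) ⟩
        2 ^ N * 0 % p                     ≡⟨ cong (_% p) (*-zeroʳ (2 ^ N)) ⟩
        0                                 ∎)))
      where
      i : ℕ
      i = n ∸ suc r
      i<n : i < n
      i<n = ∸-monoʳ-< (s≤s z≤n) (≤-pred r<p)
      h[n]≡Tʳh[i] : h n ≡ Tˢ (suc r) h i
      h[n]≡Tʳh[i] = sym (Tˢ-first-nonzero h-vanishes (suc r) i (m∸n+n≡m (≤-pred r<p)))

  isPeriod : ∀ {ℓ o} → 2 < p → IsOrderOf2 p o → suc ℓ ∣ 2 * p → (e : Vec (Fin p) (suc ℓ)) →
    (∀ j → j < n → fold p (seq e) j ≡ 0) → ¬ p ∣ fold p (seq e) n → IsPeriod p (suc ℓ) (p * o)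
  isPeriod {ℓ} {o} 2<p order ℓ∣2p e e-vanishes p∤e[n] = (e , 0<p*o , eventual e , least) , bounded
    where
    open ≡-Reasoning
    0<p*o : 0 < p * o
    0<p*o = *-mono-≤ {1} {p} (s≤s z≤n) (proj₁ order)
    eventual : ∀ a → IsEventualPeriod a (p * o)
    eventual a = eventualPeriod a p (p * o) (seq-injective _ _ λ i → begin
      seq (Tⁿ (p + p * o) a) i      ≡⟨ seq-Tⁿ (p + p * o) a i ⟩
      Tˢ (p + p * o) (seq a) i % p  ≡⟨ Tˢ-eventually-periodic order (seq-periodic a ℓ∣2p) i ⟩
      Tˢ p (seq a) i % p            ≡⟨ seq-Tⁿ p a i ⟨
      seq (Tⁿ p a) i                ∎)
    least : ∀ Q → 0 < Q → IsEventualPeriod e Q → p * o ≤ Q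
    least Q 0<Q (N , e-period) =
      eventual-period-≥ 2<p order (seq-periodic e ℓ∣2p) e-vanishes p∤e[n] N 0<Q λ k N≤k i →
        trans (sym (seq-Tⁿ (k + Q) e i)) (trans (cong (λ a → seq a i) (e-period k N≤k)) (seq-Tⁿ k e i))
    bounded : ∀ a Q → IsCycleLength a Q → Q ≤ p * o
    bounded a Q (_ , _ , Q-least) = Q-least (p * o) 0<p*o (eventual a)

  isPeriod-p : ∀ {o} → 2 < p → IsOrderOf2 p o → IsPeriod p p (p * o)
  isPeriod-p 2<p order =
    isPeriod 2<p order (n∣m*n 2) e e-vanishes (>⇒∤ 2<p ∘ subst (p ∣_) e[n]+e[n+p]≡2)
    where
    1<p : 1 < p
    1<p = <-trans (n<1+n 1) 2<p
    e : Vec (Fin p) p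
    e = onlyLast n (fromℕ< 1<p)
    e[n]≡1 : seq e n ≡ 1
    e[n]≡1 = trans (seq-onlyLast-≡ n _) (toℕ-fromℕ< 1<p)
    e-vanishes : ∀ j → j < n → seq e j + seq e (j + p) ≡ 0
    e-vanishes j j<n = cong₂ _+_ (seq-onlyLast-< _ j<n) (trans (seq-periodic e ∣-refl j) (seq-onlyLast-< _ j<n))
    e[n]+e[n+p]≡2 : seq e n + seq e (n + p) ≡ 2
    e[n]+e[n+p]≡2 = cong₂ _+_ e[n]≡1 (trans (seq-periodic e ∣-refl n) e[n]≡1)

  isPeriod-2p : ∀ {o} → 2 < p → IsOrderOf2 p o → IsPeriod p (2 * p) (p * o)
  isPeriod-2p {o} 2<p order = subst (λ L → IsPeriod p L (p * o)) 1+n+p≡2p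
    (isPeriod 2<p order (∣-reflexive 1+n+p≡2p) e e-vanishes (>⇒∤ 1<p ∘ subst (p ∣_) e[n]+e[n+p]≡1))
    where
    1+n+p≡2p : suc (n + p) ≡ 2 * p
    1+n+p≡2p = cong (λ x → suc (n + x)) (sym (+-identityʳ p))
    1<p : 1 < p
    1<p = <-trans (n<1+n 1) 2<p
    e : Vec (Fin p) (suc (n + p))
    e = onlyLast (n + p) (fromℕ< 1<p)
    e-vanishes : ∀ j → j < n → seq e j + seq e (j + p) ≡ 0
    e-vanishes j j<n = cong₂ _+_ (seq-onlyLast-< _ (≤-trans j<n (m≤m+n n p))) (seq-onlyLast-< _ (+-monoˡ-< p j<n))
    e[n]+e[n+p]≡1 : seq e n + seq e (n + p) ≡ 1
    e[n]+e[n+p]≡1 = cong₂ _+_ (seq-onlyLast-< _ (m<m+n n (s≤s z≤n)))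
                              (trans (seq-onlyLast-≡ (n + p) _) (toℕ-fromℕ< 1<p))

proposition7p2 : ∀ (p : ℕ) → Prime p → 2 < p → ∀ (o : ℕ) → IsOrderOf2 p o →
    IsPeriod p (2 * p) (p * o) × IsPeriod p p (p * o)
proposition7p2 zero    _       ()
proposition7p2 (suc n) p-prime 2<p o order = isPeriod-2p p-prime 2<p order , isPeriod-p p-prime 2<p order
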